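{- For $i\in\{1,2\}$ let $\mathscr{G}_i^*$ be a $(k,r_i)$-regular hypergraph on $n_i$ vertices. If $\mathscr{G}_1^*$ is singular, then $\mathscr{G}_1^*\barwedge\mathscr{G}_2^*$ is singular.
   Context: A $k$-uniform hypergraph has hyperedges that are $k$-element subsets of its vertex set; it is $(k,r)$-regular if every vertex lies in exactly $r$ hyperedges. Its adjacency matrix has $(i,j)$ entry equal to the number of hyperedges containing both the $i$-th and $j$-th vertex ($i\ne j$) and zero diagonal; a hypergraph is singular if $0$ is an eigenvalue of its adjacency matrix. For $\mathscr{G}^*=(V,E)$ with $V=\{v_1,\dots,v_n\}$, $NS(\mathscr{G}^*)$ has vertex set $V\cup S(\mathscr{G}^*)$, $S(\mathscr{G}^*)=\{u_1,\dots,u_n\}$ new vertices, and edge set $E\cup\{\{u_i\}\cup D: D\subset V\setminus\{v_i\}, |D|=k-1, \{v_i\}\cup D\in E\}$. For $k$-uniform $\mathscr{G}_1^*,\mathscr{G}_2^*$ on disjoint vertex sets, the neighbourhood splitting $S$-vertex join $\mathscr{G}_1^*\barwedge\mathscr{G}_2^*$ has vertex set $V(\mathscr{G}_1^*)\cup S(\mathscr{G}_1^*)\cup V(\mathscr{G}_2^*)$ and edge set $E(NS(\mathscr{G}_1^*))\cup E(\mathscr{G}_2^*)\cup\{\{u\}\cup D: u\in S(\mathscr{G}_1^*),\ D\subset V(\mathscr{G}_2^*),\ |D|=k-1\}$. -}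

module Defs where

open import Data.Nat as ℕ using (ℕ; zero; suc; _∸_; _+_)
open import Data.Bool using (Bool; true; false; _∧_; _∨_; not)
open import Data.Fin using (Fin; zero; suc)
open import Data.Fin.Subset using (Subset; _∈_; _∩_; _∪_; ∣_∣; ⊥)
open import Data.Fin.Subset.Properties using (_∈?_)
open import Data.Vec using (Vec; []; _∷_; _++_; splitAt)
open import Data.List using (List; []; _∷_; map; length; filter; concatMap)
open import Data.Product using (Σ; _,_; proj₁; proj₂; _×_)
open import Data.Integer using (+_)
open import Data.Rational using (ℚ; 0ℚ; _*_; _/_)
import Data.Rational as Q
open import Relation.Binary.PropositionalEquality using (_≡_; _≢_)
open import Relation.Nullary.Decidable using (⌊_⌋; does)
open import Data.Fin using (_≟_)

record Hypergraph (n : ℕ) : Set where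
  field
    edge : Subset n → Bool

open Hypergraph public

allSubsets : (n : ℕ) → List (Subset n)
allSubsets zero = [] ∷ []
allSubsets (suc n) = concatMap (λ s → (true ∷ s) ∷ (false ∷ s) ∷ []) (allSubsets n)

edges : ∀ {n} → Hypergraph n → List (Subset n)
edges {n} H = filter (λ e → edge H e Data.Bool.≟ true) (allSubsets n)

IsUniform : ∀ {n} → ℕ → Hypergraph n → Set
IsUniform k H = ∀ e → edge H e ≡ true → ∣ e ∣ ≡ k

degree : ∀ {n} → Hypergraph n → Fin n → ℕ
degree H v = length (filter (λ e → v ∈? e) (edges H))

IsRegular : ∀ {n} → ℕ → ℕ → Hypergraph n → Set
IsRegular k r H = IsUniform k H × (∀ v → degree H v ≡ r)

adjacency : ∀ {n} → Hypergraph n → Fin n → Fin n → ℕ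
adjacency H i j with does (i ≟ j)
... | true  = 0
... | false = length (filter (λ e → does (i ∈? e) ∧ does (j ∈? e) Data.Bool.≟ true) (edges H))

ℕ→ℚ : ℕ → ℚ
ℕ→ℚ m = (+ m) / 1

Σℚ : ∀ n → (Fin n → ℚ) → ℚ
Σℚ zero f = 0ℚ
Σℚ (suc n) f = f zero Q.+ Σℚ n (λ i → f (suc i))

Singular : ∀ {n} → Hypergraph n → Set
Singular {n} H =
  Σ (Fin n → ℚ) λ x →
    (Σ (Fin n) λ i → x i ≢ 0ℚ) ×
    (∀ i → Σℚ n (λ j → ℕ→ℚ (adjacency H i j) * x j) ≡ 0ℚ)

_=ℕ_ : ℕ → ℕ → Bool
a =ℕ b = does (a ℕ.≟ b)

-- Vertex set Fin (n₁ + n₁ + n₂): the first n₁ vertices are V(G₁)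
-- (v_i = i), the next n₁ are S(G₁) (u_i = n₁ + i), the last n₂ are V(G₂).
-- A subset e splits as (a , b , c) with a ⊆ V(G₁), b ⊆ S(G₁), c ⊆ V(G₂).
nsJoin : ∀ {n₁ n₂} → ℕ → Hypergraph n₁ → Hypergraph n₂ → Hypergraph (n₁ + n₁ + n₂)
nsJoin {n₁} {n₂} k G₁ G₂ = record { edge = E }
  where
  E : Subset (n₁ + n₁ + n₂) → Bool
  E e with splitAt (n₁ + n₁) e
  ... | ab , c , _ with splitAt n₁ ab
  ... | a , b , _ =
    (edge G₁ a ∧ (∣ b ∣ =ℕ 0) ∧ (∣ c ∣ =ℕ 0))
    -- edges {u_i} ∪ D with D ⊆ V(G₁) ∖ {v_i}, |D| = k-1, {v_i} ∪ D ∈ E(G₁)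
    ∨ ((∣ b ∣ =ℕ 1) ∧ (∣ c ∣ =ℕ 0) ∧ (∣ a ∩ b ∣ =ℕ 0)
        ∧ (∣ a ∣ =ℕ (k ∸ 1)) ∧ edge G₁ (a ∪ b))
    ∨ ((∣ a ∣ =ℕ 0) ∧ (∣ b ∣ =ℕ 0) ∧ edge G₂ c)
    ∨ ((∣ a ∣ =ℕ 0) ∧ (∣ b ∣ =ℕ 1) ∧ (∣ c ∣ =ℕ (k ∸ 1)))

{-# OPTIONS --safe #-}
-- Let x ≠ 0 with A(G₁) x = 0 and extend x by zero on S(G₁) and V(G₂); only rows of
-- the join restricted to V(G₁) matter. No edge of the join meets both V(G₁) and V(G₂),
-- so the rows of V(G₂) vanish there. A new edge {u_i} ∪ D with v_j ∈ D comes from the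
-- edge {v_i} ∪ D of G₁, so the row of u_i restricted to V(G₁) is the row of v_i in A(G₁).
-- An edge e of G₁ through v_i and v_j (i ≠ j) contributes, besides itself, one new edge
-- {u_l} ∪ (e ∖ {v_l}) through both for each of the k − 2 vertices v_l ∈ e ∖ {v_i, v_j};
-- so the row of v_i restricted to V(G₁) is k − 1 times its row in A(G₁). Hence the
-- extended vector is a null vector of the join.
module Submission where

open import Defs
open import Data.Nat using (ℕ)
open import Data.Nat as ℕ using (zero; suc; _+_; _*_; _∸_)
import Data.Nat.Properties as ℕ
open import Data.Nat.ListAction using () renaming (sum to sumList)

open import Algebra.Properties.CommutativeSemigroup ℕ.+-commutativeSemigroup
  using () renaming (interchange to +-interchange; x∙yz≈y∙xz to x+[y+z]≡y+[x+z])
open import Algebra.Properties.CommutativeSemigroup ℕ.*-commutativeSemigroup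
  using () renaming (x∙yz≈y∙xz to x*[y*z]≡y*[x*z]; x∙yz≈y∙zx to x*[y*z]≡y*[z*x];
                     x∙yz≈z∙xy to x*[y*z]≡z*[x*y])
open import Algebra.Properties.Semiring.Sum ℕ.+-*-semiring
  using (sum-syntax; sum-cong-≗; sum-replicate-zero; *-distribˡ-sum)
open import Data.Bool using (Bool; true; false; _∧_; _∨_; not)
open import Data.Bool.Properties using (∧-zeroʳ; ∧-conicalʳ)
open import Data.Fin as Fin using (Fin; zero; suc; _↑ˡ_; _↑ʳ_)
import Data.Fin.Properties as Fin
open import Data.Fin.Subset using (Subset; ∣_∣; ⊥; ⁅_⁆; _∩_; _∪_; _-_; _─_)
open import Data.Fin.Subset.Properties using (_∈?_; p─⊥≡p; ∪-identityʳ; ∩-zeroʳ; ∣⊥∣≡0)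
import Data.Integer as ℤ
import Data.Integer.Properties as ℤ
open import Data.List using (List; []; _∷_; filter; length; map; concatMap)
open import Data.Product using (_,_)
open import Data.Rational as ℚ using (ℚ; 0ℚ)
import Data.Rational.Properties as ℚ
import Data.Rational.Unnormalised as ℚᵘ
import Data.Rational.Unnormalised.Properties as ℚᵘ
open import Data.Vec using (Vec; []; _∷_; _++_; splitAt; lookup)
open import Data.Vec.Properties using (lookup-++ˡ; lookup-++ʳ; lookup-replicate)
import Data.Vec.Functional as Vector
import Data.Vec.Functional.Properties as Vector
open import Function using (_∘_)
open import Relation.Binary.PropositionalEquality
  using (_≡_; _≢_; refl; sym; trans; cong; cong₂; module ≡-Reasoning)
open import Relation.Nullary using (Dec; yes; no; contradiction)
open import Relation.Nullary.Decidable using (does; dec-true)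
open ≡-Reasoning

-- Sums over subsets

⟦_⟧ : Bool → ℕ
⟦ true  ⟧ = 1
⟦ false ⟧ = 0

⟦∧⟧ : ∀ x y → ⟦ x ∧ y ⟧ ≡ ⟦ x ⟧ * ⟦ y ⟧
⟦∧⟧ false y = refl
⟦∧⟧ true  y = sym (ℕ.*-identityˡ ⟦ y ⟧)

⟦⟧*-cong : ∀ x {m n} → (x ≡ true → m ≡ n) → ⟦ x ⟧ * m ≡ ⟦ x ⟧ * n
⟦⟧*-cong false _   = refl
⟦⟧*-cong true  m≡n = cong (1 *_) (m≡n refl)

∑ₛ : ∀ m → (Subset m → ℕ) → ℕ
∑ₛ zero    g = g []
∑ₛ (suc m) g = ∑ₛ m (λ s → g (true ∷ s)) + ∑ₛ m (λ s → g (false ∷ s))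

infix 10 ∑ₛ
syntax ∑ₛ m (λ s → x) = ∑[ s ⊆ m ] x

∑ₛ-cong : ∀ m {f g : Subset m → ℕ} → (∀ s → f s ≡ g s) → ∑ₛ m f ≡ ∑ₛ m g
∑ₛ-cong zero    f≗g = f≗g []
∑ₛ-cong (suc m) f≗g =
  cong₂ _+_ (∑ₛ-cong m (f≗g ∘ (true ∷_))) (∑ₛ-cong m (f≗g ∘ (false ∷_)))

∑ₛ-zero : ∀ m → ∑[ s ⊆ m ] 0 ≡ 0
∑ₛ-zero zero    = refl
∑ₛ-zero (suc m) = cong₂ _+_ (∑ₛ-zero m) (∑ₛ-zero m)

∑ₛ-distrib-+ : ∀ m (f g : Subset m → ℕ) → ∑[ s ⊆ m ] (f s + g s) ≡ ∑ₛ m f + ∑ₛ m g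
∑ₛ-distrib-+ zero    f g = refl
∑ₛ-distrib-+ (suc m) f g =
  trans (cong₂ _+_ (∑ₛ-distrib-+ m _ _) (∑ₛ-distrib-+ m _ _))
        (+-interchange (∑ₛ m (f ∘ (true ∷_))) (∑ₛ m (g ∘ (true ∷_)))
                       (∑ₛ m (f ∘ (false ∷_))) (∑ₛ m (g ∘ (false ∷_))))

*-distribˡ-∑ₛ : ∀ m c (f : Subset m → ℕ) → c * ∑ₛ m f ≡ ∑[ s ⊆ m ] (c * f s)
*-distribˡ-∑ₛ zero    c f = refl
*-distribˡ-∑ₛ (suc m) c f =
  trans (ℕ.*-distribˡ-+ c _ _) (cong₂ _+_ (*-distribˡ-∑ₛ m c _) (*-distribˡ-∑ₛ m c _))

∑ₛ-++ : ∀ m n (g : Subset (m + n) → ℕ) → ∑ₛ (m + n) g ≡ ∑[ a ⊆ m ] ∑[ c ⊆ n ] g (a ++ c)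
∑ₛ-++ zero    n g = refl
∑ₛ-++ (suc m) n g = cong₂ _+_ (∑ₛ-++ m n _) (∑ₛ-++ m n _)

∑-∑ₛ-comm : ∀ n m (f : Fin n → Subset m → ℕ) →
  ∑[ l < n ] ∑ₛ m (f l) ≡ ∑[ s ⊆ m ] ∑[ l < n ] f l s
∑-∑ₛ-comm zero    m f = sym (∑ₛ-zero m)
∑-∑ₛ-comm (suc n) m f =
  trans (cong (∑ₛ m (f zero) +_) (∑-∑ₛ-comm n m (f ∘ suc))) (sym (∑ₛ-distrib-+ m (f zero) _))

∑ₛ-∣∣≡0 : ∀ m (g : Subset m → ℕ) → ∑[ b ⊆ m ] (⟦ ∣ b ∣ =ℕ 0 ⟧ * g b) ≡ g ⊥
∑ₛ-∣∣≡0 zero    g = ℕ.*-identityˡ (g [])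
∑ₛ-∣∣≡0 (suc m) g =
  trans (cong (_+ ∑[ b ⊆ m ] (⟦ ∣ b ∣ =ℕ 0 ⟧ * g (false ∷ b))) (∑ₛ-zero m))
        (∑ₛ-∣∣≡0 m (g ∘ (false ∷_)))

∑ₛ-∣∣≡1 : ∀ m (g : Subset m → ℕ) → ∑[ b ⊆ m ] (⟦ ∣ b ∣ =ℕ 1 ⟧ * g b) ≡ ∑[ l < m ] g ⁅ l ⁆
∑ₛ-∣∣≡1 zero    g = refl
∑ₛ-∣∣≡1 (suc m) g = cong₂ _+_ (∑ₛ-∣∣≡0 m (g ∘ (true ∷_))) (∑ₛ-∣∣≡1 m (g ∘ (false ∷_)))

∑ₛ-insert : ∀ m (l : Fin m) (f : Subset m → Subset m → ℕ) →
  ∑[ a ⊆ m ] (⟦ not (lookup a l) ⟧ * f (a ∪ ⁅ l ⁆) a) ≡ ∑[ e ⊆ m ] (⟦ lookup e l ⟧ * f e (e - l))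
∑ₛ-insert (suc m) zero f = begin
  ∑[ a ⊆ m ] 0 + ∑[ a ⊆ m ] (1 * f (true ∷ a ∪ ⊥) (false ∷ a))
    ≡⟨ cong₂ _+_ (∑ₛ-zero m) (∑ₛ-cong m shift) ⟩
  ∑[ e ⊆ m ] (1 * f (true ∷ e) (false ∷ (e ─ ⊥)))
    ≡⟨ ℕ.+-identityʳ _ ⟨
  ∑[ e ⊆ m ] (1 * f (true ∷ e) (false ∷ (e ─ ⊥))) + 0
    ≡⟨ cong (∑[ e ⊆ m ] (1 * f (true ∷ e) (false ∷ (e ─ ⊥))) +_) (∑ₛ-zero m) ⟨
  ∑[ e ⊆ m ] (1 * f (true ∷ e) (false ∷ (e ─ ⊥))) + ∑[ e ⊆ m ] 0 ∎
  where
  shift : ∀ a → 1 * f (true ∷ a ∪ ⊥) (false ∷ a) ≡ 1 * f (true ∷ a) (false ∷ (a ─ ⊥))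
  shift a = cong₂ (λ s t → 1 * f (true ∷ s) (false ∷ t)) (∪-identityʳ a) (sym (p─⊥≡p a))
∑ₛ-insert (suc m) (suc l) f = cong₂ _+_ (∑ₛ-insert m l (λ e a → f (true ∷ e) (true ∷ a)))
                                        (∑ₛ-insert m l (λ e a → f (false ∷ e) (false ∷ a)))

-- Sums over the elements of a subset

∑∈ : ∀ {n} → Subset n → (Fin n → ℕ) → ℕ
∑∈ {n} p g = ∑[ l < n ] (⟦ lookup p l ⟧ * g l)

infix 10 ∑∈
syntax ∑∈ p (λ l → x) = ∑[ l ∈ p ] x

∑∈-cong : ∀ {n} (p : Subset n) {f g : Fin n → ℕ} →
  (∀ l → lookup p l ≡ true → f l ≡ g l) → ∑∈ p f ≡ ∑∈ p g
∑∈-cong p f≗g = sum-cong-≗ (λ l → ⟦⟧*-cong (lookup p l) (f≗g l))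

∑∈-zero : ∀ {n} (p : Subset n) {g : Fin n → ℕ} → (∀ l → g l ≡ 0) → ∑∈ p g ≡ 0
∑∈-zero {n} p g≗0 =
  trans (sum-cong-≗ λ l → trans (cong (⟦ lookup p l ⟧ *_) (g≗0 l)) (ℕ.*-zeroʳ ⟦ lookup p l ⟧))
        (sum-replicate-zero n)

∣p∣≡∑∈1 : ∀ {n} (p : Subset n) → ∣ p ∣ ≡ ∑[ l ∈ p ] 1
∣p∣≡∑∈1 []          = refl
∣p∣≡∑∈1 (true  ∷ p) = cong suc (∣p∣≡∑∈1 p)
∣p∣≡∑∈1 (false ∷ p) = ∣p∣≡∑∈1 p

∑∈-remove : ∀ {n} (p : Subset n) x (g : Fin n → ℕ) →
  lookup p x ≡ true → ∑∈ p g ≡ g x + ∑∈ (p - x) g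
∑∈-remove (true ∷ p) zero g _ =
  cong₂ _+_ (ℕ.*-identityˡ (g zero)) (cong (λ q → ∑∈ q (g ∘ suc)) (sym (p─⊥≡p p)))
∑∈-remove (b ∷ p) (suc x) g p∋x =
  trans (cong (⟦ b ⟧ * g zero +_) (∑∈-remove p x (g ∘ suc) p∋x))
        (x+[y+z]≡y+[x+z] (⟦ b ⟧ * g zero) (g (suc x)) (∑∈ (p - x) (g ∘ suc)))

∑-⁅⁆ : ∀ {n} (i : Fin n) (h : Fin n → ℕ) → ∑[ l < n ] (⟦ lookup ⁅ l ⁆ i ⟧ * h l) ≡ h i
∑-⁅⁆ {suc n} zero h =
  trans (cong₂ _+_ (ℕ.*-identityˡ (h zero)) (sum-replicate-zero n)) (ℕ.+-identityʳ (h zero))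
∑-⁅⁆ {suc n} (suc i) h =
  trans (cong (λ b → ⟦ b ⟧ * h zero + ∑[ l < n ] (⟦ lookup ⁅ l ⁆ i ⟧ * h (suc l)))
              (lookup-replicate i false))
        (∑-⁅⁆ i (h ∘ suc))

lookup-remove-self : ∀ {n} (p : Subset n) x → lookup (p - x) x ≡ false
lookup-remove-self (b ∷ p) zero    = refl
lookup-remove-self (b ∷ p) (suc x) = lookup-remove-self p x

lookup-remove-≢ : ∀ {n} (p : Subset n) {x y} → x ≢ y → lookup (p - x) y ≡ lookup p y
lookup-remove-≢ (b ∷ p) {zero}  {zero}  x≢y = contradiction refl x≢y
lookup-remove-≢ (b ∷ p) {zero}  {suc y} _   = cong (λ q → lookup q y) (p─⊥≡p p)
lookup-remove-≢ (b ∷ p) {suc x} {zero}  _   = refl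
lookup-remove-≢ (b ∷ p) {suc x} {suc y} x≢y = lookup-remove-≢ p (x≢y ∘ cong suc)

lookup-remove≡true⇒≢ : ∀ {n} (p : Subset n) {x y} → lookup (p - x) y ≡ true → x ≢ y
lookup-remove≡true⇒≢ p {x} p-x∋x refl with trans (sym p-x∋x) (lookup-remove-self p x)
... | ()

lookup-remove-false : ∀ {n} (p : Subset n) x {y} → lookup p y ≡ false → lookup (p - x) y ≡ false
lookup-remove-false p x {y} p∌y with x Fin.≟ y
... | yes refl = lookup-remove-self p x
... | no  x≢y  = trans (lookup-remove-≢ p x≢y) p∌y

-- Only the l ∉ {i, j} keep both i and j in e - l, and there are ∣ e ∣ ∸ 2 of them.
∑∈-removed-pair : ∀ {n} (e : Subset n) {i j} → i ≢ j →
  ∑[ l ∈ e ] ⟦ lookup (e - l) i ∧ lookup (e - l) j ⟧ ≡ ⟦ lookup e i ∧ lookup e j ⟧ * (∣ e ∣ ∸ 2)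
∑∈-removed-pair e {i} {j} i≢j with lookup e i in e∋i | lookup e j in e∋j
... | false | _     = ∑∈-zero e λ l →
  cong (λ b → ⟦ b ∧ lookup (e - l) j ⟧) (lookup-remove-false e l e∋i)
... | true  | false = ∑∈-zero e λ l →
  trans (cong (λ b → ⟦ lookup (e - l) i ∧ b ⟧) (lookup-remove-false e l e∋j))
        (cong ⟦_⟧ (∧-zeroʳ (lookup (e - l) i)))
... | true  | true  = begin
  ∑[ l ∈ e ] h l                 ≡⟨ ∑∈-remove e i h e∋i ⟩
  h i + ∑[ l ∈ e - i ] h l       ≡⟨ cong (_+ ∑∈ (e - i) h) h[i]≡0 ⟩
  ∑[ l ∈ e - i ] h l             ≡⟨ ∑∈-remove (e - i) j h e-i∋j ⟩
  h j + ∑[ l ∈ e - i - j ] h l   ≡⟨ cong (_+ ∑∈ (e - i - j) h) h[j]≡0 ⟩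
  ∑[ l ∈ e - i - j ] h l         ≡⟨ ∑∈-cong (e - i - j) h≡1 ⟩
  ∑[ l ∈ e - i - j ] 1           ≡⟨ cong (_∸ 2) ∣e∣≡2+rest ⟨
  ∣ e ∣ ∸ 2                      ≡⟨ ℕ.*-identityˡ _ ⟨
  1 * (∣ e ∣ ∸ 2)                ∎
  where
  h : Fin _ → ℕ
  h l = ⟦ lookup (e - l) i ∧ lookup (e - l) j ⟧
  e-i∋j : lookup (e - i) j ≡ true
  e-i∋j = trans (lookup-remove-≢ e i≢j) e∋j
  h[i]≡0 : h i ≡ 0
  h[i]≡0 = cong (λ b → ⟦ b ∧ lookup (e - i) j ⟧) (lookup-remove-self e i)
  h[j]≡0 : h j ≡ 0
  h[j]≡0 = trans (cong (λ b → ⟦ lookup (e - j) i ∧ b ⟧) (lookup-remove-self e j))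
                 (cong ⟦_⟧ (∧-zeroʳ (lookup (e - j) i)))
  h≡1 : ∀ l → lookup (e - i - j) l ≡ true → h l ≡ 1
  h≡1 l e-i-j∋l = cong₂ (λ x y → ⟦ x ∧ y ⟧)
    (trans (lookup-remove-≢ e (i≢l ∘ sym)) e∋i) (trans (lookup-remove-≢ e (j≢l ∘ sym)) e∋j)
    where
    j≢l = lookup-remove≡true⇒≢ (e - i) e-i-j∋l
    i≢l = lookup-remove≡true⇒≢ e (trans (sym (lookup-remove-≢ (e - i) j≢l)) e-i-j∋l)
  ∣e∣≡2+rest : ∣ e ∣ ≡ 2 + ∑[ l ∈ e - i - j ] 1
  ∣e∣≡2+rest = trans (∣p∣≡∑∈1 e)
    (trans (∑∈-remove e i _ e∋i) (cong suc (∑∈-remove (e - i) j _ e-i∋j)))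

-- Adjacency as a codegree

codegree : ∀ {n} → Hypergraph n → Fin n → Fin n → ℕ
codegree {n} H i j = ∑[ e ⊆ n ] (⟦ edge H e ⟧ * ⟦ lookup e i ∧ lookup e j ⟧)

length-filter-filter : ∀ {A : Set} (P Q : A → Bool) (xs : List A) →
  length (filter (λ x → P x Data.Bool.≟ true) (filter (λ x → Q x Data.Bool.≟ true) xs))
  ≡ sumList (map (λ x → ⟦ Q x ⟧ * ⟦ P x ⟧) xs)
length-filter-filter P Q []       = refl
length-filter-filter P Q (x ∷ xs) with Q x
... | false = length-filter-filter P Q xs
... | true with P x
...   | false = length-filter-filter P Q xs
...   | true  = cong suc (length-filter-filter P Q xs)

sumList-allSubsets : ∀ m (g : Subset m → ℕ) → sumList (map g (allSubsets m)) ≡ ∑ₛ m g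
sumList-allSubsets zero    g = ℕ.+-identityʳ (g [])
sumList-allSubsets (suc m) g = begin
  sumList (map g (concatMap (λ s → (true ∷ s) ∷ (false ∷ s) ∷ []) (allSubsets m)))
    ≡⟨ doubling (allSubsets m) ⟩
  sumList (map (λ s → g (true ∷ s) + g (false ∷ s)) (allSubsets m))
    ≡⟨ sumList-allSubsets m _ ⟩
  ∑[ s ⊆ m ] (g (true ∷ s) + g (false ∷ s))
    ≡⟨ ∑ₛ-distrib-+ m _ _ ⟩
  ∑ₛ (suc m) g ∎
  where
  doubling : ∀ ss → sumList (map g (concatMap (λ s → (true ∷ s) ∷ (false ∷ s) ∷ []) ss))
                  ≡ sumList (map (λ s → g (true ∷ s) + g (false ∷ s)) ss)
  doubling []       = refl
  doubling (s ∷ ss) = trans (sym (ℕ.+-assoc (g (true ∷ s)) _ _))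
                            (cong (g (true ∷ s) + g (false ∷ s) +_) (doubling ss))

does-∈?≡lookup : ∀ {n} (i : Fin n) (s : Subset n) → does (i ∈? s) ≡ lookup s i
does-∈?≡lookup zero    (true  ∷ s) = refl
does-∈?≡lookup zero    (false ∷ s) = refl
does-∈?≡lookup (suc i) (_ ∷ s)     = does-∈?≡lookup i s

adjacency-≢ : ∀ {n} (H : Hypergraph n) {i j} → i ≢ j → adjacency H i j ≡ codegree H i j
adjacency-≢ {n} H {i} {j} i≢j with i Fin.≟ j
... | yes i≡j = contradiction i≡j i≢j
... | no  _   = begin
  _ ≡⟨ length-filter-filter _ (edge H) (allSubsets n) ⟩
  _ ≡⟨ sumList-allSubsets n _ ⟩
  _ ≡⟨ ∑ₛ-cong n (λ e → cong₂ (λ x y → ⟦ edge H e ⟧ * ⟦ x ∧ y ⟧)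
                              (does-∈?≡lookup i e) (does-∈?≡lookup j e)) ⟩
  codegree H i j ∎

adjacency-diag : ∀ {n} (H : Hypergraph n) i → adjacency H i i ≡ 0
adjacency-diag H i with i Fin.≟ i
... | yes _   = refl
... | no  i≢i = contradiction refl i≢i

-- Split edges

=ℕ-true : ∀ {m n} → m ≡ n → (m =ℕ n) ≡ true
=ℕ-true {m} {n} = dec-true (m ℕ.≟ n)

x∈p⇒∣p∣=ℕ0≡false : ∀ {n} {p : Subset n} {x} → lookup p x ≡ true → (∣ p ∣ =ℕ 0) ≡ false
x∈p⇒∣p∣=ℕ0≡false {p = true  ∷ p} {zero}  _   = refl
x∈p⇒∣p∣=ℕ0≡false {p = true  ∷ p} {suc x} _   = refl
x∈p⇒∣p∣=ℕ0≡false {p = false ∷ p} {suc x} p∋x = x∈p⇒∣p∣=ℕ0≡false {p = p} p∋x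

∣∩⁅⁆∣=ℕ0 : ∀ {n} (a : Subset n) l → (∣ a ∩ ⁅ l ⁆ ∣ =ℕ 0) ≡ not (lookup a l)
∣∩⁅⁆∣=ℕ0         (true  ∷ a) zero    = refl
∣∩⁅⁆∣=ℕ0 {suc n} (false ∷ a) zero    = cong (_=ℕ 0) (trans (cong ∣_∣ (∩-zeroʳ a)) (∣⊥∣≡0 n))
∣∩⁅⁆∣=ℕ0         (true  ∷ a) (suc l) = ∣∩⁅⁆∣=ℕ0 a l
∣∩⁅⁆∣=ℕ0         (false ∷ a) (suc l) = ∣∩⁅⁆∣=ℕ0 a l

∣∪⁅⁆∣ : ∀ {n} (a : Subset n) l → lookup a l ≡ false → ∣ a ∪ ⁅ l ⁆ ∣ ≡ suc ∣ a ∣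
∣∪⁅⁆∣ (false ∷ a) zero    _   = cong (suc ∘ ∣_∣) (∪-identityʳ a)
∣∪⁅⁆∣ (true  ∷ a) (suc l) a∌l = cong suc (∣∪⁅⁆∣ a l a∌l)
∣∪⁅⁆∣ (false ∷ a) (suc l) a∌l = ∣∪⁅⁆∣ a l a∌l

-- splitEdge k G a ⁅ l ⁆ says that {u_l} ∪ a is an edge of NS(G): a ∪ {v_l} ∈ E(G), v_l ∉ a.
splitEdge : ∀ {n} → ℕ → Hypergraph n → Subset n → Subset n → Bool
splitEdge k G a b = (∣ a ∩ b ∣ =ℕ 0) ∧ (∣ a ∣ =ℕ (k ∸ 1)) ∧ edge G (a ∪ b)

module _ {n k} {G : Hypergraph n} (uniform : IsUniform k G) where

  ⟦splitEdge-⁅⁆⟧ : ∀ a l → ⟦ splitEdge k G a ⁅ l ⁆ ⟧ ≡ ⟦ not (lookup a l) ⟧ * ⟦ edge G (a ∪ ⁅ l ⁆) ⟧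
  ⟦splitEdge-⁅⁆⟧ a l rewrite ∣∩⁅⁆∣=ℕ0 a l with lookup a l in a∌l | edge G (a ∪ ⁅ l ⁆) in isEdge
  ... | true  | _     = refl
  ... | false | false = cong ⟦_⟧ (∧-zeroʳ (∣ a ∣ =ℕ (k ∸ 1)))
  ... | false | true  rewrite =ℕ-true (cong (_∸ 1) (trans (sym (∣∪⁅⁆∣ a l a∌l)) (uniform _ isEdge)))
    = refl

  ∑ₛ-splitEdge-⁅⁆ : ∀ l (Y : Subset n → ℕ) →
    ∑[ a ⊆ n ] (⟦ splitEdge k G a ⁅ l ⁆ ⟧ * Y a) ≡ ∑[ e ⊆ n ] (⟦ lookup e l ⟧ * (⟦ edge G e ⟧ * Y (e - l)))
  ∑ₛ-splitEdge-⁅⁆ l Y = begin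
    ∑[ a ⊆ n ] (⟦ splitEdge k G a ⁅ l ⁆ ⟧ * Y a)
      ≡⟨ ∑ₛ-cong n (λ a → trans (cong (_* Y a) (⟦splitEdge-⁅⁆⟧ a l))
                                (ℕ.*-assoc ⟦ not (lookup a l) ⟧ ⟦ edge G (a ∪ ⁅ l ⁆) ⟧ (Y a))) ⟩
    ∑[ a ⊆ n ] (⟦ not (lookup a l) ⟧ * (⟦ edge G (a ∪ ⁅ l ⁆) ⟧ * Y a))
      ≡⟨ ∑ₛ-insert n l (λ e a → ⟦ edge G e ⟧ * Y a) ⟩
    ∑[ e ⊆ n ] (⟦ lookup e l ⟧ * (⟦ edge G e ⟧ * Y (e - l))) ∎

  -- Each edge e ∋ i, j of G is counted once for every l ∈ e ∖ {i, j}.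
  splitEdges-through-pair : ∀ {i j} → i ≢ j →
    ∑[ a ⊆ n ] ∑[ l < n ] (⟦ splitEdge k G a ⁅ l ⁆ ⟧ * ⟦ lookup a i ∧ lookup a j ⟧)
    ≡ (k ∸ 2) * codegree G i j
  splitEdges-through-pair {i} {j} i≢j = begin
    ∑[ a ⊆ n ] ∑[ l < n ] (⟦ splitEdge k G a ⁅ l ⁆ ⟧ * Y a)
      ≡⟨ ∑-∑ₛ-comm n n _ ⟨
    ∑[ l < n ] ∑[ a ⊆ n ] (⟦ splitEdge k G a ⁅ l ⁆ ⟧ * Y a)
      ≡⟨ sum-cong-≗ (λ l → ∑ₛ-splitEdge-⁅⁆ l Y) ⟩
    ∑[ l < n ] ∑[ e ⊆ n ] (⟦ lookup e l ⟧ * (⟦ edge G e ⟧ * Y (e - l)))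
      ≡⟨ ∑-∑ₛ-comm n n _ ⟩
    ∑[ e ⊆ n ] ∑[ l < n ] (⟦ lookup e l ⟧ * (⟦ edge G e ⟧ * Y (e - l)))
      ≡⟨ ∑ₛ-cong n per-edge ⟩
    ∑[ e ⊆ n ] ((k ∸ 2) * (⟦ edge G e ⟧ * Y e))
      ≡⟨ *-distribˡ-∑ₛ n (k ∸ 2) _ ⟨
    (k ∸ 2) * codegree G i j ∎
    where
    Y : Subset n → ℕ
    Y a = ⟦ lookup a i ∧ lookup a j ⟧
    per-edge : ∀ e → ∑[ l < n ] (⟦ lookup e l ⟧ * (⟦ edge G e ⟧ * Y (e - l)))
                   ≡ (k ∸ 2) * (⟦ edge G e ⟧ * Y e)
    per-edge e = begin
      ∑[ l < n ] (⟦ lookup e l ⟧ * (⟦ edge G e ⟧ * Y (e - l)))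
        ≡⟨ sum-cong-≗ (λ l → x*[y*z]≡y*[x*z] ⟦ lookup e l ⟧ ⟦ edge G e ⟧ (Y (e - l))) ⟩
      ∑[ l < n ] (⟦ edge G e ⟧ * (⟦ lookup e l ⟧ * Y (e - l)))
        ≡⟨ *-distribˡ-sum ⟦ edge G e ⟧ (λ l → ⟦ lookup e l ⟧ * Y (e - l)) ⟨
      ⟦ edge G e ⟧ * ∑[ l ∈ e ] Y (e - l)
        ≡⟨ cong (⟦ edge G e ⟧ *_) (∑∈-removed-pair e i≢j) ⟩
      ⟦ edge G e ⟧ * (Y e * (∣ e ∣ ∸ 2))
        ≡⟨ ⟦⟧*-cong (edge G e) (λ isEdge → cong (λ m → Y e * (m ∸ 2)) (uniform e isEdge)) ⟩
      ⟦ edge G e ⟧ * (Y e * (k ∸ 2))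
        ≡⟨ x*[y*z]≡z*[x*y] ⟦ edge G e ⟧ (Y e) (k ∸ 2) ⟩
      (k ∸ 2) * (⟦ edge G e ⟧ * Y e) ∎

  splitEdges-at : ∀ i j → ∑[ a ⊆ n ] (⟦ splitEdge k G a ⁅ i ⁆ ⟧ * ⟦ lookup a j ⟧) ≡ adjacency G i j
  splitEdges-at i j = trans (∑ₛ-splitEdge-⁅⁆ i (λ a → ⟦ lookup a j ⟧)) (by-cases (i Fin.≟ j))
    where
    Z : Subset n → Bool → ℕ
    Z e b = ⟦ lookup e i ⟧ * (⟦ edge G e ⟧ * ⟦ b ⟧)
    by-cases : Dec (i ≡ j) → ∑[ e ⊆ n ] Z e (lookup (e - i) j) ≡ adjacency G i j
    by-cases (yes refl) = begin
      ∑[ e ⊆ n ] Z e (lookup (e - i) i)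
        ≡⟨ ∑ₛ-cong n (λ e → cong (Z e) (lookup-remove-self e i)) ⟩
      ∑[ e ⊆ n ] (⟦ lookup e i ⟧ * (⟦ edge G e ⟧ * 0))
        ≡⟨ ∑ₛ-cong n (λ e → trans (cong (⟦ lookup e i ⟧ *_) (ℕ.*-zeroʳ ⟦ edge G e ⟧))
                                  (ℕ.*-zeroʳ ⟦ lookup e i ⟧)) ⟩
      ∑[ e ⊆ n ] 0
        ≡⟨ trans (∑ₛ-zero n) (sym (adjacency-diag G i)) ⟩
      adjacency G i i ∎
    by-cases (no i≢j) = begin
      ∑[ e ⊆ n ] Z e (lookup (e - i) j)
        ≡⟨ ∑ₛ-cong n (λ e → cong (Z e) (lookup-remove-≢ e i≢j)) ⟩
      ∑[ e ⊆ n ] (⟦ lookup e i ⟧ * (⟦ edge G e ⟧ * ⟦ lookup e j ⟧))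
        ≡⟨ ∑ₛ-cong n (λ e → trans (x*[y*z]≡y*[x*z] ⟦ lookup e i ⟧ ⟦ edge G e ⟧ ⟦ lookup e j ⟧)
                                  (cong (⟦ edge G e ⟧ *_) (sym (⟦∧⟧ (lookup e i) (lookup e j))))) ⟩
      codegree G i j
        ≡⟨ adjacency-≢ G i≢j ⟨
      adjacency G i j ∎

-- The neighbourhood splitting S-vertex join

splitAt-++ : ∀ {A : Set} m {n} (xs : Vec A m) (ys : Vec A n) → splitAt m (xs ++ ys) ≡ (xs , ys , refl)
splitAt-++ zero    []       ys = refl
splitAt-++ (suc m) (x ∷ xs) ys rewrite splitAt-++ m xs ys = refl

↑ˡ≢↑ʳ : ∀ {m n} (i : Fin m) (j : Fin n) → i ↑ˡ n ≢ m ↑ʳ j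
↑ˡ≢↑ʳ zero    j ()
↑ˡ≢↑ʳ (suc i) j eq = ↑ˡ≢↑ʳ i j (Fin.suc-injective eq)

data SumView (m n : ℕ) : Fin (m + n) → Set where
  left  : ∀ i → SumView m n (i ↑ˡ n)
  right : ∀ i → SumView m n (m ↑ʳ i)

sumView : ∀ m n (p : Fin (m + n)) → SumView m n p
sumView zero    n p       = right p
sumView (suc m) n zero    = left zero
sumView (suc m) n (suc p) with sumView m n p
... | left  i = left (suc i)
... | right i = right i

-- The edge predicate of nsJoin once a nonempty part in V(G₁) has falsified its last two disjuncts.
⟦⟧-by-size : ∀ m x y c₀ → ⟦ (x ∧ (m =ℕ 0) ∧ c₀) ∨ ((m =ℕ 1) ∧ c₀ ∧ y) ∨ false ⟧
                         ≡ ⟦ c₀ ⟧ * (⟦ m =ℕ 0 ⟧ * ⟦ x ⟧ + ⟦ m =ℕ 1 ⟧ * ⟦ y ⟧)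
⟦⟧-by-size zero          false y     false = refl
⟦⟧-by-size zero          false y     true  = refl
⟦⟧-by-size zero          true  y     false = refl
⟦⟧-by-size zero          true  y     true  = refl
⟦⟧-by-size (suc zero)    false y     false = refl
⟦⟧-by-size (suc zero)    true  y     false = refl
⟦⟧-by-size (suc zero)    false false true  = refl
⟦⟧-by-size (suc zero)    false true  true  = refl
⟦⟧-by-size (suc zero)    true  false true  = refl
⟦⟧-by-size (suc zero)    true  true  true  = refl
⟦⟧-by-size (suc (suc m)) false y     false = refl
⟦⟧-by-size (suc (suc m)) false y     true  = refl
⟦⟧-by-size (suc (suc m)) true  y     false = refl
⟦⟧-by-size (suc (suc m)) true  y     true  = refl

module Join {n₁ n₂ : ℕ} (k : ℕ) (G₁ : Hypergraph n₁) (G₂ : Hypergraph n₂)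
            (uniform₁ : IsUniform k G₁) where

  J : Hypergraph (n₁ + n₁ + n₂)
  J = nsJoin k G₁ G₂

  v u : Fin n₁ → Fin (n₁ + n₁ + n₂)
  v i = (i ↑ˡ n₁) ↑ˡ n₂
  u i = (n₁ ↑ʳ i) ↑ˡ n₂

  w : Fin n₂ → Fin (n₁ + n₁ + n₂)
  w i = (n₁ + n₁) ↑ʳ i

  joinEdge : Subset n₁ → Subset n₁ → Subset n₂ → Bool
  joinEdge a b c = (edge G₁ a ∧ (∣ b ∣ =ℕ 0) ∧ (∣ c ∣ =ℕ 0))
    ∨ ((∣ b ∣ =ℕ 1) ∧ (∣ c ∣ =ℕ 0) ∧ splitEdge k G₁ a b)
    ∨ ((∣ a ∣ =ℕ 0) ∧ (∣ b ∣ =ℕ 0) ∧ edge G₂ c)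
    ∨ ((∣ a ∣ =ℕ 0) ∧ (∣ b ∣ =ℕ 1) ∧ (∣ c ∣ =ℕ (k ∸ 1)))

  edge-J : ∀ a b c → edge J ((a ++ b) ++ c) ≡ joinEdge a b c
  edge-J a b c rewrite splitAt-++ (n₁ + n₁) (a ++ b) c | splitAt-++ n₁ a b = refl

  lookup-v : ∀ i (a b : Subset n₁) (c : Subset n₂) → lookup ((a ++ b) ++ c) (v i) ≡ lookup a i
  lookup-v i a b c = trans (lookup-++ˡ (a ++ b) c (i ↑ˡ n₁)) (lookup-++ˡ a b i)

  lookup-u : ∀ i (a b : Subset n₁) (c : Subset n₂) → lookup ((a ++ b) ++ c) (u i) ≡ lookup b i
  lookup-u i a b c = trans (lookup-++ˡ (a ++ b) c (n₁ ↑ʳ i)) (lookup-++ʳ a b i)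

  lookup-w : ∀ i (a b : Subset n₁) (c : Subset n₂) → lookup ((a ++ b) ++ c) (w i) ≡ lookup c i
  lookup-w i a b c = lookup-++ʳ (a ++ b) c i

  v≢v : ∀ {i j} → i ≢ j → v i ≢ v j
  v≢v i≢j eq = i≢j (Fin.↑ˡ-injective n₁ _ _ (Fin.↑ˡ-injective n₂ _ _ eq))

  u≢v : ∀ i j → u i ≢ v j
  u≢v i j eq = ↑ˡ≢↑ʳ j i (sym (Fin.↑ˡ-injective n₂ _ _ eq))

  w≢v : ∀ i j → w i ≢ v j
  w≢v i j eq = ↑ˡ≢↑ʳ (j ↑ˡ n₁) i (sym eq)

  ∑³ : (Subset n₁ → Subset n₁ → Subset n₂ → ℕ) → ℕ
  ∑³ f = ∑[ a ⊆ n₁ ] ∑[ b ⊆ n₁ ] ∑[ c ⊆ n₂ ] f a b c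

  ∑³-cong : ∀ {f g} → (∀ a b c → f a b c ≡ g a b c) → ∑³ f ≡ ∑³ g
  ∑³-cong f≗g = ∑ₛ-cong n₁ λ a → ∑ₛ-cong n₁ λ b → ∑ₛ-cong n₂ λ c → f≗g a b c

  adjacency-J : ∀ {p q} {ρ σ : Subset n₁ → Subset n₁ → Subset n₂ → Bool} → p ≢ q →
    (∀ a b c → lookup ((a ++ b) ++ c) p ≡ ρ a b c) → (∀ a b c → lookup ((a ++ b) ++ c) q ≡ σ a b c) →
    adjacency J p q ≡ ∑³ (λ a b c → ⟦ joinEdge a b c ⟧ * ⟦ ρ a b c ∧ σ a b c ⟧)
  adjacency-J {p} {q} {ρ} {σ} p≢q p≡ρ q≡σ = begin
    adjacency J p q
      ≡⟨ adjacency-≢ J p≢q ⟩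
    ∑ₛ (n₁ + n₁ + n₂) g
      ≡⟨ ∑ₛ-++ (n₁ + n₁) n₂ g ⟩
    ∑ₛ (n₁ + n₁) (λ ab → ∑[ c ⊆ n₂ ] g (ab ++ c))
      ≡⟨ ∑ₛ-++ n₁ n₁ _ ⟩
    ∑³ (λ a b c → g ((a ++ b) ++ c))
      ≡⟨ ∑³-cong (λ a b c → cong₂ (λ x y → ⟦ x ⟧ * ⟦ y ⟧)
                                  (edge-J a b c) (cong₂ _∧_ (p≡ρ a b c) (q≡σ a b c))) ⟩
    ∑³ (λ a b c → ⟦ joinEdge a b c ⟧ * ⟦ ρ a b c ∧ σ a b c ⟧) ∎
    where
    g : Subset (n₁ + n₁ + n₂) → ℕ
    g s = ⟦ edge J s ⟧ * ⟦ lookup s p ∧ lookup s q ⟧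

  ⟦joinEdge⟧-meeting-V : ∀ {a j} → lookup a j ≡ true → ∀ b c → ⟦ joinEdge a b c ⟧
    ≡ ⟦ ∣ c ∣ =ℕ 0 ⟧ * (⟦ ∣ b ∣ =ℕ 0 ⟧ * ⟦ edge G₁ a ⟧ + ⟦ ∣ b ∣ =ℕ 1 ⟧ * ⟦ splitEdge k G₁ a b ⟧)
  ⟦joinEdge⟧-meeting-V {a} a∋j b c rewrite x∈p⇒∣p∣=ℕ0≡false {p = a} a∋j =
    ⟦⟧-by-size ∣ b ∣ (edge G₁ a) (splitEdge k G₁ a b) (∣ c ∣ =ℕ 0)

  ∑-meeting-V : ∀ j (X : Subset n₁ → Subset n₁ → Bool) → (∀ a b → X a b ≡ true → lookup a j ≡ true) →
    ∑³ (λ a b c → ⟦ joinEdge a b c ⟧ * ⟦ X a b ⟧)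
    ≡ ∑[ a ⊆ n₁ ] (⟦ edge G₁ a ⟧ * ⟦ X a ⊥ ⟧ + ∑[ l < n₁ ] (⟦ splitEdge k G₁ a ⁅ l ⁆ ⟧ * ⟦ X a ⁅ l ⁆ ⟧))
  ∑-meeting-V j X X⇒a∋j = ∑ₛ-cong n₁ fibre
    where
    fibre : ∀ a → ∑[ b ⊆ n₁ ] ∑[ c ⊆ n₂ ] (⟦ joinEdge a b c ⟧ * ⟦ X a b ⟧)
                ≡ ⟦ edge G₁ a ⟧ * ⟦ X a ⊥ ⟧ + ∑[ l < n₁ ] (⟦ splitEdge k G₁ a ⁅ l ⁆ ⟧ * ⟦ X a ⁅ l ⁆ ⟧)
    fibre a = begin
      ∑[ b ⊆ n₁ ] ∑[ c ⊆ n₂ ] (⟦ joinEdge a b c ⟧ * ⟦ X a b ⟧)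
        ≡⟨ ∑ₛ-cong n₁ (λ b → ∑ₛ-cong n₂ (pointwise b)) ⟩
      ∑[ b ⊆ n₁ ] ∑[ c ⊆ n₂ ] (⟦ ∣ c ∣ =ℕ 0 ⟧ * (K b * ⟦ X a b ⟧))
        ≡⟨ ∑ₛ-cong n₁ (λ b → ∑ₛ-∣∣≡0 n₂ (λ _ → K b * ⟦ X a b ⟧)) ⟩
      ∑[ b ⊆ n₁ ] (K b * ⟦ X a b ⟧)
        ≡⟨ ∑ₛ-cong n₁ distribute ⟩
      ∑[ b ⊆ n₁ ] (⟦ ∣ b ∣ =ℕ 0 ⟧ * S₀ b + ⟦ ∣ b ∣ =ℕ 1 ⟧ * S₁ b)
        ≡⟨ ∑ₛ-distrib-+ n₁ (λ b → ⟦ ∣ b ∣ =ℕ 0 ⟧ * S₀ b) (λ b → ⟦ ∣ b ∣ =ℕ 1 ⟧ * S₁ b) ⟩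
      ∑[ b ⊆ n₁ ] (⟦ ∣ b ∣ =ℕ 0 ⟧ * S₀ b) + ∑[ b ⊆ n₁ ] (⟦ ∣ b ∣ =ℕ 1 ⟧ * S₁ b)
        ≡⟨ cong₂ _+_ (∑ₛ-∣∣≡0 n₁ S₀) (∑ₛ-∣∣≡1 n₁ S₁) ⟩
      S₀ ⊥ + ∑[ l < n₁ ] S₁ ⁅ l ⁆ ∎
      where
      K S₀ S₁ : Subset n₁ → ℕ
      K b = ⟦ ∣ b ∣ =ℕ 0 ⟧ * ⟦ edge G₁ a ⟧ + ⟦ ∣ b ∣ =ℕ 1 ⟧ * ⟦ splitEdge k G₁ a b ⟧
      S₀ b = ⟦ edge G₁ a ⟧ * ⟦ X a b ⟧
      S₁ b = ⟦ splitEdge k G₁ a b ⟧ * ⟦ X a b ⟧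
      pointwise : ∀ b c → ⟦ joinEdge a b c ⟧ * ⟦ X a b ⟧ ≡ ⟦ ∣ c ∣ =ℕ 0 ⟧ * (K b * ⟦ X a b ⟧)
      pointwise b c = begin
        ⟦ joinEdge a b c ⟧ * ⟦ X a b ⟧
          ≡⟨ ℕ.*-comm ⟦ joinEdge a b c ⟧ ⟦ X a b ⟧ ⟩
        ⟦ X a b ⟧ * ⟦ joinEdge a b c ⟧
          ≡⟨ ⟦⟧*-cong (X a b) (λ Xab → ⟦joinEdge⟧-meeting-V (X⇒a∋j a b Xab) b c) ⟩
        ⟦ X a b ⟧ * (⟦ ∣ c ∣ =ℕ 0 ⟧ * K b)
          ≡⟨ x*[y*z]≡y*[z*x] ⟦ X a b ⟧ ⟦ ∣ c ∣ =ℕ 0 ⟧ (K b) ⟩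
        ⟦ ∣ c ∣ =ℕ 0 ⟧ * (K b * ⟦ X a b ⟧) ∎
      distribute : ∀ b → K b * ⟦ X a b ⟧ ≡ ⟦ ∣ b ∣ =ℕ 0 ⟧ * S₀ b + ⟦ ∣ b ∣ =ℕ 1 ⟧ * S₁ b
      distribute b =
        trans (ℕ.*-distribʳ-+ ⟦ X a b ⟧ (⟦ ∣ b ∣ =ℕ 0 ⟧ * ⟦ edge G₁ a ⟧) (⟦ ∣ b ∣ =ℕ 1 ⟧ * ⟦ splitEdge k G₁ a b ⟧))
              (cong₂ _+_ (ℕ.*-assoc ⟦ ∣ b ∣ =ℕ 0 ⟧ ⟦ edge G₁ a ⟧ ⟦ X a b ⟧)
                         (ℕ.*-assoc ⟦ ∣ b ∣ =ℕ 1 ⟧ ⟦ splitEdge k G₁ a b ⟧ ⟦ X a b ⟧))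

  adjacency-v-v : ∀ i j → adjacency J (v i) (v j) ≡ suc (k ∸ 2) * adjacency G₁ i j
  adjacency-v-v i j = by-cases (i Fin.≟ j)
    where
    by-cases : Dec (i ≡ j) → adjacency J (v i) (v j) ≡ suc (k ∸ 2) * adjacency G₁ i j
    by-cases (yes refl) = begin
      adjacency J (v i) (v i)            ≡⟨ adjacency-diag J (v i) ⟩
      0                                  ≡⟨ ℕ.*-zeroʳ (suc (k ∸ 2)) ⟨
      suc (k ∸ 2) * 0                    ≡⟨ cong (suc (k ∸ 2) *_) (adjacency-diag G₁ i) ⟨
      suc (k ∸ 2) * adjacency G₁ i i     ∎
    by-cases (no i≢j) = begin
      adjacency J (v i) (v j)
        ≡⟨ adjacency-J (v≢v i≢j) (lookup-v i) (lookup-v j) ⟩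
      ∑³ (λ a b c → ⟦ joinEdge a b c ⟧ * ⟦ lookup a i ∧ lookup a j ⟧)
        ≡⟨ ∑-meeting-V j (λ a _ → lookup a i ∧ lookup a j) (λ a _ → ∧-conicalʳ (lookup a i) (lookup a j)) ⟩
      ∑[ a ⊆ n₁ ] (⟦ edge G₁ a ⟧ * ⟦ lookup a i ∧ lookup a j ⟧
                   + ∑[ l < n₁ ] (⟦ splitEdge k G₁ a ⁅ l ⁆ ⟧ * ⟦ lookup a i ∧ lookup a j ⟧))
        ≡⟨ ∑ₛ-distrib-+ n₁ _ _ ⟩
      codegree G₁ i j + ∑[ a ⊆ n₁ ] ∑[ l < n₁ ] (⟦ splitEdge k G₁ a ⁅ l ⁆ ⟧ * ⟦ lookup a i ∧ lookup a j ⟧)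
        ≡⟨ cong (codegree G₁ i j +_) (splitEdges-through-pair uniform₁ i≢j) ⟩
      codegree G₁ i j + (k ∸ 2) * codegree G₁ i j
        ≡⟨ cong (λ m → m + (k ∸ 2) * m) (adjacency-≢ G₁ i≢j) ⟨
      suc (k ∸ 2) * adjacency G₁ i j ∎

  adjacency-u-v : ∀ i j → adjacency J (u i) (v j) ≡ adjacency G₁ i j
  adjacency-u-v i j = begin
    adjacency J (u i) (v j)
      ≡⟨ adjacency-J (u≢v i j) (lookup-u i) (lookup-v j) ⟩
    ∑³ (λ a b c → ⟦ joinEdge a b c ⟧ * ⟦ lookup b i ∧ lookup a j ⟧)
      ≡⟨ ∑-meeting-V j (λ a b → lookup b i ∧ lookup a j) (λ a b → ∧-conicalʳ (lookup b i) (lookup a j)) ⟩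
    ∑[ a ⊆ n₁ ] (⟦ edge G₁ a ⟧ * ⟦ lookup ⊥ i ∧ lookup a j ⟧
                 + ∑[ l < n₁ ] (⟦ splitEdge k G₁ a ⁅ l ⁆ ⟧ * ⟦ lookup ⁅ l ⁆ i ∧ lookup a j ⟧))
      ≡⟨ ∑ₛ-cong n₁ only-u-i ⟩
    ∑[ a ⊆ n₁ ] (⟦ splitEdge k G₁ a ⁅ i ⁆ ⟧ * ⟦ lookup a j ⟧)
      ≡⟨ splitEdges-at uniform₁ i j ⟩
    adjacency G₁ i j ∎
    where
    only-u-i : ∀ a → ⟦ edge G₁ a ⟧ * ⟦ lookup ⊥ i ∧ lookup a j ⟧
                     + ∑[ l < n₁ ] (⟦ splitEdge k G₁ a ⁅ l ⁆ ⟧ * ⟦ lookup ⁅ l ⁆ i ∧ lookup a j ⟧)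
                   ≡ ⟦ splitEdge k G₁ a ⁅ i ⁆ ⟧ * ⟦ lookup a j ⟧
    only-u-i a = begin
      ⟦ edge G₁ a ⟧ * ⟦ lookup ⊥ i ∧ lookup a j ⟧ + T
        ≡⟨ cong (λ b → ⟦ edge G₁ a ⟧ * ⟦ b ∧ lookup a j ⟧ + T) (lookup-replicate i false) ⟩
      ⟦ edge G₁ a ⟧ * 0 + T
        ≡⟨ cong₂ _+_ (ℕ.*-zeroʳ ⟦ edge G₁ a ⟧) (sum-cong-≗ λ l →
             trans (cong (⟦ S l ⟧ *_) (⟦∧⟧ (lookup ⁅ l ⁆ i) (lookup a j)))
                   (x*[y*z]≡y*[x*z] ⟦ S l ⟧ ⟦ lookup ⁅ l ⁆ i ⟧ ⟦ lookup a j ⟧)) ⟩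
      ∑[ l < n₁ ] (⟦ lookup ⁅ l ⁆ i ⟧ * (⟦ S l ⟧ * ⟦ lookup a j ⟧))
        ≡⟨ ∑-⁅⁆ i (λ l → ⟦ S l ⟧ * ⟦ lookup a j ⟧) ⟩
      ⟦ S i ⟧ * ⟦ lookup a j ⟧ ∎
      where
      S : Fin n₁ → Bool
      S l = splitEdge k G₁ a ⁅ l ⁆
      T : ℕ
      T = ∑[ l < n₁ ] (⟦ S l ⟧ * ⟦ lookup ⁅ l ⁆ i ∧ lookup a j ⟧)

  adjacency-w-v : ∀ i j → adjacency J (w i) (v j) ≡ 0
  adjacency-w-v i j = begin
    adjacency J (w i) (v j)
      ≡⟨ adjacency-J (w≢v i j) (lookup-w i) (lookup-v j) ⟩
    ∑³ (λ a b c → ⟦ joinEdge a b c ⟧ * ⟦ lookup c i ∧ lookup a j ⟧)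
      ≡⟨ ∑³-cong vanish ⟩
    ∑³ (λ _ _ _ → 0)
      ≡⟨ ∑ₛ-cong n₁ (λ _ → trans (∑ₛ-cong n₁ (λ _ → ∑ₛ-zero n₂)) (∑ₛ-zero n₁)) ⟩
    ∑[ a ⊆ n₁ ] 0
      ≡⟨ ∑ₛ-zero n₁ ⟩
    0 ∎
    where
    -- No edge of the join meets both V(G₁) and V(G₂).
    vanish : ∀ a b c → ⟦ joinEdge a b c ⟧ * ⟦ lookup c i ∧ lookup a j ⟧ ≡ 0
    vanish a b c with lookup c i in c∋i | lookup a j in a∋j
    ... | false | _     = ℕ.*-zeroʳ ⟦ joinEdge a b c ⟧
    ... | true  | false = ℕ.*-zeroʳ ⟦ joinEdge a b c ⟧
    ... | true  | true  = begin
      ⟦ joinEdge a b c ⟧ * 1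
        ≡⟨ cong (_* 1) (⟦joinEdge⟧-meeting-V a∋j b c) ⟩
      ⟦ ∣ c ∣ =ℕ 0 ⟧ * K * 1
        ≡⟨ cong (λ x → ⟦ x ⟧ * K * 1) (x∈p⇒∣p∣=ℕ0≡false {p = c} c∋i) ⟩
      0 ∎
      where
      K : ℕ
      K = ⟦ ∣ b ∣ =ℕ 0 ⟧ * ⟦ edge G₁ a ⟧ + ⟦ ∣ b ∣ =ℕ 1 ⟧ * ⟦ splitEdge k G₁ a b ⟧

-- Null vectors

ℕ→ℚ-* : ∀ m n → ℕ→ℚ (m * n) ≡ ℕ→ℚ m ℚ.* ℕ→ℚ n
ℕ→ℚ-* m n = ℚ.toℚᵘ-injective (begin-≃
  ℚ.toℚᵘ (ℕ→ℚ (m * n))                     ≈⟨ fromℕ (m * n) ⟩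
  ℚᵘ.mkℚᵘ (ℤ.+ (m * n)) 0                  ≈⟨ ℚᵘ.*≡* (cong (ℤ._* ℤ.+ 1) (ℤ.pos-* m n)) ⟩
  ℚᵘ.mkℚᵘ (ℤ.+ m) 0 ℚᵘ.* ℚᵘ.mkℚᵘ (ℤ.+ n) 0  ≈⟨ ℚᵘ.*-cong (fromℕ m) (fromℕ n) ⟨
  ℚ.toℚᵘ (ℕ→ℚ m) ℚᵘ.* ℚ.toℚᵘ (ℕ→ℚ n)       ≈⟨ ℚ.toℚᵘ-homo-* (ℕ→ℚ m) (ℕ→ℚ n) ⟨
  ℚ.toℚᵘ (ℕ→ℚ m ℚ.* ℕ→ℚ n)                 ∎-≃)
  where
  open ℚᵘ.≃-Reasoning using (step-≈-⟩; step-≈-⟨) renaming (begin_ to begin-≃_; _∎ to _∎-≃)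
  fromℕ : ∀ m → ℚ.toℚᵘ (ℕ→ℚ m) ℚᵘ.≃ ℚᵘ.mkℚᵘ (ℤ.+ m) 0
  fromℕ m = ℚ.toℚᵘ-fromℚᵘ (ℚᵘ.mkℚᵘ (ℤ.+ m) 0)

Σℚ-cong : ∀ n {f g : Fin n → ℚ} → (∀ i → f i ≡ g i) → Σℚ n f ≡ Σℚ n g
Σℚ-cong zero    f≗g = refl
Σℚ-cong (suc n) f≗g = cong₂ ℚ._+_ (f≗g zero) (Σℚ-cong n (f≗g ∘ suc))

Σℚ-zero : ∀ n → Σℚ n (λ _ → 0ℚ) ≡ 0ℚ
Σℚ-zero zero    = refl
Σℚ-zero (suc n) = trans (cong (0ℚ ℚ.+_) (Σℚ-zero n)) (ℚ.+-identityˡ 0ℚ)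

*-distribˡ-Σℚ : ∀ n c (f : Fin n → ℚ) → c ℚ.* Σℚ n f ≡ Σℚ n (λ i → c ℚ.* f i)
*-distribˡ-Σℚ zero    c f = ℚ.*-zeroʳ c
*-distribˡ-Σℚ (suc n) c f =
  trans (ℚ.*-distribˡ-+ c (f zero) _) (cong (c ℚ.* f zero ℚ.+_) (*-distribˡ-Σℚ n c (f ∘ suc)))

Σℚ-++ : ∀ m n (f : Fin (m + n) → ℚ) →
  Σℚ (m + n) f ≡ Σℚ m (λ i → f (i ↑ˡ n)) ℚ.+ Σℚ n (λ i → f (m ↑ʳ i))
Σℚ-++ zero    n f = sym (ℚ.+-identityˡ _)
Σℚ-++ (suc m) n f =
  trans (cong (f zero ℚ.+_) (Σℚ-++ m n (f ∘ suc))) (sym (ℚ.+-assoc (f zero) _ _))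

dot : ∀ {n} → (Fin n → ℕ) → (Fin n → ℚ) → ℚ
dot {n} r x = Σℚ n (λ j → ℕ→ℚ (r j) ℚ.* x j)

dot-cong : ∀ {n} {r s : Fin n → ℕ} → (∀ j → r j ≡ s j) → ∀ x → dot r x ≡ dot s x
dot-cong r≗s x = Σℚ-cong _ (λ j → cong (λ m → ℕ→ℚ m ℚ.* x j) (r≗s j))

dot-*ˡ : ∀ {n} c (r : Fin n → ℕ) x → dot (λ j → c * r j) x ≡ ℕ→ℚ c ℚ.* dot r x
dot-*ˡ {n} c r x = trans
  (Σℚ-cong n (λ j → trans (cong (ℚ._* x j) (ℕ→ℚ-* c (r j))) (ℚ.*-assoc (ℕ→ℚ c) (ℕ→ℚ (r j)) (x j))))
  (sym (*-distribˡ-Σℚ n (ℕ→ℚ c) _))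

dot-zeroˡ : ∀ {n} x → dot {n} (λ _ → 0) x ≡ 0ℚ
dot-zeroˡ {n} x = trans (Σℚ-cong n (λ j → ℚ.*-zeroˡ (x j))) (Σℚ-zero n)

dot-padded : ∀ {m n} (r : Fin (m + n) → ℕ) (x : Fin m → ℚ) →
  dot r (x Vector.++ Vector.replicate n 0ℚ) ≡ dot (λ i → r (i ↑ˡ n)) x
dot-padded {m} {n} r x = begin
  dot r x₀
    ≡⟨ Σℚ-++ m n _ ⟩
  Σℚ m (λ i → ℕ→ℚ (r (i ↑ˡ n)) ℚ.* x₀ (i ↑ˡ n)) ℚ.+ Σℚ n (λ i → ℕ→ℚ (r (m ↑ʳ i)) ℚ.* x₀ (m ↑ʳ i))
    ≡⟨ cong₂ ℚ._+_ (Σℚ-cong m λ i → cong (ℕ→ℚ (r (i ↑ˡ n)) ℚ.*_) (Vector.lookup-++ˡ x _ i))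
                   (trans (Σℚ-cong n λ i → trans (cong (ℕ→ℚ (r (m ↑ʳ i)) ℚ.*_) (Vector.lookup-++ʳ x _ i))
                                                 (ℚ.*-zeroʳ (ℕ→ℚ (r (m ↑ʳ i)))))
                          (Σℚ-zero n)) ⟩
  dot (λ i → r (i ↑ˡ n)) x ℚ.+ 0ℚ
    ≡⟨ ℚ.+-identityʳ _ ⟩
  dot (λ i → r (i ↑ˡ n)) x ∎
  where
  x₀ = x Vector.++ Vector.replicate n 0ℚ

corollary4p5 : (k r₁ r₂ n₁ n₂ : ℕ) (G₁ : Hypergraph n₁) (G₂ : Hypergraph n₂) →
    IsRegular k r₁ G₁ → IsRegular k r₂ G₂ →
    Singular G₁ → Singular (nsJoin k G₁ G₂)
corollary4p5 k r₁ r₂ n₁ n₂ G₁ G₂ (uniform₁ , _) _ (x , (i₀ , x[i₀]≢0) , Ax≡0) =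
  x₀ , (v i₀ , x[i₀]≢0 ∘ trans (sym x₀[v]≡x)) , Ax₀≡0
  where
  open Join k G₁ G₂ uniform₁
  x′ : Fin (n₁ + n₁) → ℚ
  x′ = x Vector.++ Vector.replicate n₁ 0ℚ
  x₀ : Fin (n₁ + n₁ + n₂) → ℚ
  x₀ = x′ Vector.++ Vector.replicate n₂ 0ℚ
  x₀[v]≡x : x₀ (v i₀) ≡ x i₀
  x₀[v]≡x = trans (Vector.lookup-++ˡ x′ _ (i₀ ↑ˡ n₁)) (Vector.lookup-++ˡ x _ i₀)
  row : ∀ p → dot (λ j → adjacency J p (v j)) x ≡ 0ℚ
  row p with sumView (n₁ + n₁) n₂ p
  ... | right i = trans (dot-cong (adjacency-w-v i) x) (dot-zeroˡ x)
  ... | left q with sumView n₁ n₁ q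
  ...   | right i = trans (dot-cong (adjacency-u-v i) x) (Ax≡0 i)
  ...   | left i  = begin
    dot (λ j → adjacency J (v i) (v j)) x         ≡⟨ dot-cong (adjacency-v-v i) x ⟩
    dot (λ j → suc (k ∸ 2) * adjacency G₁ i j) x  ≡⟨ dot-*ˡ (suc (k ∸ 2)) (adjacency G₁ i) x ⟩
    ℕ→ℚ (suc (k ∸ 2)) ℚ.* dot (adjacency G₁ i) x  ≡⟨ cong (ℕ→ℚ (suc (k ∸ 2)) ℚ.*_) (Ax≡0 i) ⟩
    ℕ→ℚ (suc (k ∸ 2)) ℚ.* 0ℚ                      ≡⟨ ℚ.*-zeroʳ (ℕ→ℚ (suc (k ∸ 2))) ⟩
    0ℚ                                            ∎
  Ax₀≡0 : ∀ p → dot (adjacency J p) x₀ ≡ 0ℚ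
  Ax₀≡0 p = begin
    dot (adjacency J p) x₀                  ≡⟨ dot-padded {n₁ + n₁} (adjacency J p) x′ ⟩
    dot (λ q → adjacency J p (q ↑ˡ n₂)) x′  ≡⟨ dot-padded {n₁} (λ q → adjacency J p (q ↑ˡ n₂)) x ⟩
    dot (λ j → adjacency J p (v j)) x       ≡⟨ row p ⟩
    0ℚ                                      ∎
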